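{- Let $G=\sum_{\mathbf{a}\in\mathrm{PF}}\mathbf{F}_\mathbf{a}$, the sum of $\mathbf{F}_\mathbf{a}$ over all parking functions, in the completion of $\mathbf{PQSym}$. Then $G=\sum_{\pi\in\mathrm{NDPF}}\mathbf{P}^\pi\in\mathbf{CQSym}$. Define the bilinear map $B(F,H)=F\succ\mathbf{P}^1\prec H$ on $\mathbf{CQSym}$. Then $G$ satisfies $$G=1+B(G,G).$$ Moreover, for every binary tree $T$, the term $B_T(1)$ of the tree expansion of the solution is a single basis element $\mathbf{P}^{\pi(T)}$, and $G=\sum_T B_T(1)$. Here $B_T(1)$ is defined recursively by $B_\emptyset(1)=1$ and $B_T(1)=B(B_L(1),B_R(1))$ for a tree $T$ with left subtree $L$ and right subtree $R$. Consequently $T\mapsto\pi(T)$ is a bijection between binary trees with $n$ nodes and nondecreasing parking functions of length $n$, for every $n$.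
   Context: A nondecreasing parking function (element of $\mathrm{NDPF}$) of length $n$ is a nondecreasing word $\pi_1\cdots\pi_n$ of positive integers with $\pi_i\le i$. A parking function (element of $\mathrm{PF}$) is any rearrangement of such a word. $\mathbf{PQSym}$ has basis $\mathbf{F}_\mathbf{a}$ indexed by parking functions. $\mathbf{CQSym}$ is its subalgebra with basis $\mathbf{P}^\pi=\sum_{\mathbf{a}^\uparrow=\pi}\mathbf{F}_\mathbf{a}$ ($\pi\in\mathrm{NDPF}$, including the empty word, with $\mathbf{P}^\emptyset=1$). Here $\mathbf{a}^\uparrow$ is the nondecreasing rearrangement of $\mathbf{a}$. For a word $\beta$, $\beta[k]$ adds $k$ to each letter. On $\mathbf{CQSym}$ the operations are: - $\mathbf{P}^\alpha\succ\mathbf{P}^\beta=\mathbf{P}^{\alpha\cdot\beta[|\alpha|]}$ (the usual product); - $\mathbf{P}^\alpha\prec\mathbf{P}^\beta=\mathbf{P}^{\alpha\cdot\beta[\max(\alpha)-1]}$ for nonempty $\alpha,\beta$, where $\cdot$ is concatenation. With the unit conventions $1\succ y=y$ and $y\prec1=y$, these form a duplicial structure, so $F\succ\mathbf{P}^1\prec H$ is unambiguous. -}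

module Defs where

open import Data.Nat using (ℕ; zero; suc; _+_; _*_; _∸_; _≤_; _≤?_; _⊔_)
open import Data.Nat.Properties using (≤-decTotalOrder)
import Data.Nat as ℕ
open import Data.Nat.ListAction using (sum)
open import Data.List using (List; []; _∷_; _++_; map; length; concatMap; upTo; filter; foldr; [_])
open import Data.List.Properties using (≡-dec)
open import Data.List.Relation.Unary.Linked using (Linked; linked?)
open import Data.List.Relation.Binary.Permutation.Propositional using (_↭_)
open import Data.List.Sort.InsertionSort ≤-decTotalOrder using (sort)
open import Data.Unit using (⊤; tt)
open import Data.Product using (Σ; _×_; _,_; ∃)
open import Data.Bool using (if_then_else_)
open import Relation.Nullary using (Dec; yes; no)
open import Relation.Nullary.Decidable using (_×-dec_; ⌊_⌋)
open import Relation.Binary.PropositionalEquality using (_≡_)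

Word : Set
Word = List ℕ

_≟w_ : (u v : Word) → Dec (u ≡ v)
_≟w_ = ≡-dec ℕ._≟_

Bounded : ℕ → Word → Set
Bounded i []       = ⊤
Bounded i (x ∷ xs) = (1 ≤ x × x ≤ i) × Bounded (suc i) xs

bounded? : ∀ i w → Dec (Bounded i w)
bounded? i []       = yes tt
bounded? i (x ∷ xs) = ((1 ≤? x) ×-dec (x ≤? i)) ×-dec bounded? (suc i) xs

IsNDPF : Word → Set
IsNDPF π = Linked _≤_ π × Bounded 1 π

isNDPF? : ∀ π → Dec (IsNDPF π)
isNDPF? π = linked? _≤?_ π ×-dec bounded? 1 π

IsPF : Word → Set
IsPF a = ∃ λ π → IsNDPF π × (a ↭ π)

_↑ : Word → Word
a ↑ = sort a

words : ℕ → ℕ → List Word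
words zero    m = [ [] ]
words (suc n) m = concatMap (λ x → map (x ∷_) (words n m)) (map suc (upTo m))

NDPFs : ℕ → List Word
NDPFs n = filter isNDPF? (words n n)

indicator : {A : Set} → Dec A → ℕ
indicator (yes _) = 1
indicator (no _)  = 0

-- Completion of PQSym: coefficient functions  a ↦ coefficient of F_a
-- (only parking functions a are meaningful indices).

PQ : Set
PQ = Word → ℕ

-- P^π = Σ_{a↑ = π} F_a, as an element of PQSym
P-PQ : Word → PQ
P-PQ π a = indicator ((a ↑) ≟w π)

-- Σ_{π ∈ NDPF} P^π in the completion of PQSym (computed degreewise:
-- P^π is homogeneous of degree |π|)
sumAllP-PQ : PQ
sumAllP-PQ a = sum (map (λ π → P-PQ π a) (NDPFs (length a)))

-- Completion of CQSym: coefficient functions  π ↦ coefficient of P^π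
-- (only NDPF π are meaningful indices; equality is tested on those).

CQ : Set
CQ = Word → ℕ

_≈_ : CQ → CQ → Set
F ≈ H = ∀ π → IsNDPF π → F π ≡ H π

_⊕_ : CQ → CQ → CQ
(F ⊕ H) π = F π + H π

P : Word → CQ
P π ρ = indicator (ρ ≟w π)

𝟙 : CQ
𝟙 = P []

shift : ℕ → Word → Word
shift k β = map (k +_) β

maxW : Word → ℕ
maxW = foldr _⊔_ 0

-- operations on basis indices:  P^α ≻ P^β = P^(α·β[|α|]),
-- P^α ≺ P^β = P^(α·β[max α − 1])
-- (the unit conventions 1 ≻ y = y and y ≺ 1 = y agree with these formulas)
succW : Word → Word → Word
succW α β = α ++ shift (length α) β

precW : Word → Word → Word
precW α β = α ++ shift (maxW α ∸ 1) β

-- P^α ≻ P^1 ≺ P^β  (bracketed as (P^α ≻ P^1) ≺ P^β; duplicial, so unambiguous)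
BW : Word → Word → Word
BW α β = precW (succW α [ 1 ]) β

-- bilinear extension of B to the completion of CQSym:
-- coefficient of P^π in B(F,H) = Σ_{α,β ∈ NDPF, |α|+|β|+1=|π|, BW α β = π} F(α) H(β)
B : CQ → CQ → CQ
B F H π =
  sum (map (λ k →
    sum (map (λ α →
      sum (map (λ β → if ⌊ BW α β ≟w π ⌋ then F α * H β else 0)
               (NDPFs (length π ∸ 1 ∸ k))))
        (NDPFs k)))
    (upTo (length π)))

-- Σ_{π ∈ NDPF} P^π as an element of the completion of CQSym
sumAllP : CQ
sumAllP π = 1

data Tree : Set where
  leaf : Tree
  node : Tree → Tree → Tree

size : Tree → ℕ
size leaf       = 0
size (node l r) = suc (size l + size r)

BT : Tree → CQ
BT leaf       = 𝟙
BT (node l r) = B (BT l) (BT r)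

_≟t_ : (s t : Tree) → Dec (s ≡ t)
leaf ≟t leaf = yes Relation.Binary.PropositionalEquality.refl
leaf ≟t node _ _ = no (λ ())
node _ _ ≟t leaf = no (λ ())
node l r ≟t node l' r' with l ≟t l' | r ≟t r'
... | yes Relation.Binary.PropositionalEquality.refl | yes Relation.Binary.PropositionalEquality.refl = yes Relation.Binary.PropositionalEquality.refl
... | no ¬p | _ = no (λ { Relation.Binary.PropositionalEquality.refl → ¬p Relation.Binary.PropositionalEquality.refl })
... | yes _ | no ¬q = no (λ { Relation.Binary.PropositionalEquality.refl → ¬q Relation.Binary.PropositionalEquality.refl })

treesDepth : ℕ → List Tree
treesDepth zero    = [ leaf ]
treesDepth (suc d) = leaf ∷ concatMap (λ l → map (node l) (treesDepth d)) (treesDepth d)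

-- all binary trees with exactly n nodes (they have depth ≤ n), each once
treesOfSize : ℕ → List Tree
treesOfSize n = filter (λ t → size t ℕ.≟ n) (treesDepth n)

-- Σ_T B_T(1) in the completion (degreewise; B_T(1) has degree size T)
sumTrees : CQ
sumTrees π = sum (map (λ t → BT t π) (treesOfSize (length π)))

module Submission where

-- The proof rests on one combinatorial fact: for nondecreasing parking
-- functions α and β the word  BW α β = α · (|α|+1) · β[|α|]  is again an
-- NDPF, and every nonempty NDPF arises this way from exactly one pair
-- (α, β).  (The letter |α|+1 sits at the last position i with π_i = i.)

open import Defs
open import Data.Nat using (ℕ; zero; suc; _+_; _*_; _∸_; _≤_; _<_; z≤n; s≤s; _⊔_)
import Data.Nat as ℕ
open import Data.Nat.Properties
open import Data.Nat.ListAction using (sum)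
open import Data.Nat.ListAction.Properties using (sum-++)
open import Data.List using (List; []; _∷_; _++_; map; length; concatMap; concat; upTo; filter; [_])
import Data.List.Properties as LP
open import Data.List.Relation.Unary.All as All using (All; []; _∷_)
import Data.List.Relation.Unary.All.Properties as AllP
open import Data.List.Relation.Unary.Any using (here; there)
open import Data.List.Relation.Unary.Linked as Linked using (Linked; []; [-]; _∷_)
open import Data.List.Membership.Propositional using (_∈_; _∉_)
open import Data.List.Membership.Propositional.Properties using (∈-filter⁻; ∈-upTo⁺)
open import Data.List.Relation.Unary.Unique.Propositional using (Unique)
open import Data.List.Relation.Unary.AllPairs using (_∷_)
open import Data.List.Relation.Unary.Unique.Propositional.Properties using (upTo⁺)
open import Data.List.Relation.Binary.Permutation.Propositional using (_↭_; ↭⇒↭ₛ; ↭-trans)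
open import Data.List.Relation.Binary.Permutation.Propositional.Properties using (↭-length)
open import Data.List.Relation.Binary.Pointwise using (Pointwise-≡⇒≡)
open import Data.List.Sort.InsertionSort ≤-decTotalOrder using (sort)
open import Data.List.Sort.InsertionSort.Properties ≤-decTotalOrder using (sort-↭; sort-↗)
import Data.List.Relation.Unary.Sorted.TotalOrder.Properties as Sorted
open import Relation.Binary.Bundles using (DecTotalOrder)
open import Data.Bool using (if_then_else_)
open import Data.Product using (Σ; _×_; _,_; proj₁; proj₂)
open import Data.Sum using (_⊎_; inj₁; inj₂)
open import Data.Unit using (⊤; tt)
open import Data.Empty using (⊥; ⊥-elim)
open import Relation.Nullary using (yes; no; ¬_)
open import Relation.Nullary.Decidable using (⌊_⌋)
open import Relation.Unary using (Decidable)
open import Relation.Binary.Definitions using (DecidableEquality)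
open import Relation.Binary.PropositionalEquality hiding ([_])
open ≡-Reasoning

sum-zero : {A : Set} (f : A → ℕ) (xs : List A) → (∀ x → x ∈ xs → f x ≡ 0) →
           sum (map f xs) ≡ 0
sum-zero f []       h = refl
sum-zero f (x ∷ xs) h = cong₂ _+_ (h x (here refl)) (sum-zero f xs (λ z m → h z (there m)))

sum-concat : {A : Set} (f : A → ℕ) (xss : List (List A)) →
             sum (map f (concat xss)) ≡ sum (map (λ xs → sum (map f xs)) xss)
sum-concat f []         = refl
sum-concat f (xs ∷ xss) = begin
  sum (map f (xs ++ concat xss))            ≡⟨ cong sum (LP.map-++ f xs (concat xss)) ⟩
  sum (map f xs ++ map f (concat xss))      ≡⟨ sum-++ (map f xs) _ ⟩
  sum (map f xs) + sum (map f (concat xss)) ≡⟨ cong (sum (map f xs) +_) (sum-concat f xss) ⟩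
  sum (map f xs) + sum (map (λ ys → sum (map f ys)) xss) ∎

module Counting {A : Set} (_≟_ : DecidableEquality A) where

  count : A → List A → ℕ
  count y xs = sum (map (λ x → indicator (x ≟ y)) xs)

  sum-supported : (f : A → ℕ) (y : A) (xs : List A) →
                  (∀ x → x ∈ xs → x ≢ y → f x ≡ 0) → sum (map f xs) ≡ count y xs * f y
  sum-supported f y []       h = refl
  sum-supported f y (x ∷ xs) h with x ≟ y
  ... | yes refl = cong (f x +_) (sum-supported f y xs (λ z z∈ → h z (there z∈)))
  ... | no ne    = cong₂ _+_ (h x (here refl) ne) (sum-supported f y xs (λ z z∈ → h z (there z∈)))

  sum-point : (f : A → ℕ) (y : A) (xs : List A) → count y xs ≡ 1 →
              (∀ x → x ∈ xs → x ≢ y → f x ≡ 0) → sum (map f xs) ≡ f y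
  sum-point f y xs once h = begin
    sum (map f xs)    ≡⟨ sum-supported f y xs h ⟩
    count y xs * f y  ≡⟨ cong (_* f y) once ⟩
    1 * f y           ≡⟨ *-identityˡ (f y) ⟩
    f y               ∎

  count-absent : (y : A) (xs : List A) → y ∉ xs → count y xs ≡ 0
  count-absent y []       _ = refl
  count-absent y (x ∷ xs) n with x ≟ y
  ... | yes refl = ⊥-elim (n (here refl))
  ... | no _     = count-absent y xs (λ m → n (there m))

  count-unique : (y : A) (xs : List A) → Unique xs → y ∈ xs → count y xs ≡ 1
  count-unique y (x ∷ xs) (h ∷ u) m with x ≟ y
  ... | yes refl = cong suc (count-absent y xs (λ m' → All.lookup h m' refl))
  count-unique y (x ∷ xs) (h ∷ u) (here e)  | no ne = ⊥-elim (ne (sym e))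
  count-unique y (x ∷ xs) (h ∷ u) (there m) | no ne = count-unique y xs u m

  count-filter : {P : A → Set} (P? : Decidable P) (y : A) (xs : List A) → P y →
                 count y (filter P? xs) ≡ count y xs
  count-filter P? y []       p = refl
  count-filter P? y (x ∷ xs) p with P? x
  ... | yes _ = cong (indicator (x ≟ y) +_) (count-filter P? y xs p)
  ... | no ¬px with x ≟ y
  ...   | yes refl = ⊥-elim (¬px p)
  ...   | no _     = count-filter P? y xs p

module CountingPairs {A B C : Set}
    (_≟A_ : DecidableEquality A) (_≟B_ : DecidableEquality B) (_≟C_ : DecidableEquality C)
    (g : A → B → C) (g-injective : ∀ {a b a' b'} → g a b ≡ g a' b' → a ≡ a' × b ≡ b') where
  open Counting _≟A_ using () renaming (count to countA; sum-supported to sum-supportedA)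
  open Counting _≟B_ using () renaming (count to countB)
  open Counting _≟C_ using () renaming (count to countC)

  pairs : List A → List B → List C
  pairs xs ys = concatMap (λ x → map (g x) ys) xs

  count-pairs-row : (c : C) (xs : List A) (ys : List B) →
    countC c (pairs xs ys) ≡ sum (map (λ x → countC c (map (g x) ys)) xs)
  count-pairs-row c xs ys = begin
    countC c (concat (map (λ x → map (g x) ys) xs))
      ≡⟨ sum-concat _ (map (λ x → map (g x) ys) xs) ⟩
    sum (map (countC c) (map (λ x → map (g x) ys) xs))
      ≡⟨ cong sum (sym (LP.map-∘ xs)) ⟩
    sum (map (λ x → countC c (map (g x) ys)) xs) ∎

  count-row-same : (a : A) (b : B) (ys : List B) → countC (g a b) (map (g a) ys) ≡ countB b ys
  count-row-same a b []       = refl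
  count-row-same a b (y ∷ ys) with g a y ≟C g a b | y ≟B b
  ... | yes _ | yes _    = cong suc (count-row-same a b ys)
  ... | yes e | no ne    = ⊥-elim (ne (proj₂ (g-injective e)))
  ... | no ne | yes refl = ⊥-elim (ne refl)
  ... | no _  | no _     = count-row-same a b ys

  count-row-absent : (c : C) (x : A) (ys : List B) → (∀ y → g x y ≢ c) → countC c (map (g x) ys) ≡ 0
  count-row-absent c x []       _ = refl
  count-row-absent c x (y ∷ ys) h with g x y ≟C c
  ... | yes e = ⊥-elim (h y e)
  ... | no _  = count-row-absent c x ys h

  count-pairs : (a : A) (b : B) (xs : List A) (ys : List B) →
                countC (g a b) (pairs xs ys) ≡ countA a xs * countB b ys
  count-pairs a b xs ys = begin
    countC (g a b) (pairs xs ys)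
      ≡⟨ count-pairs-row (g a b) xs ys ⟩
    sum (map (λ x → countC (g a b) (map (g x) ys)) xs)
      ≡⟨ sum-supportedA _ a xs (λ x _ x≢a → count-row-absent (g a b) x ys
                                 (λ y e → x≢a (proj₁ (g-injective e)))) ⟩
    countA a xs * countC (g a b) (map (g a) ys)
      ≡⟨ cong (countA a xs *_) (count-row-same a b ys) ⟩
    countA a xs * countB b ys ∎

  count-pairs-absent : (c : C) (xs : List A) (ys : List B) → (∀ a b → g a b ≢ c) →
                       countC c (pairs xs ys) ≡ 0
  count-pairs-absent c xs ys h = trans (count-pairs-row c xs ys)
    (sum-zero _ xs (λ x _ → count-row-absent c x ys (h x)))

open Counting ℕ._≟_ using () renaming (count to countℕ; count-unique to count-uniqueℕ)
open Counting _≟w_ using () renaming (count to countW; sum-point to sum-pointW; count-filter to count-filterW)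
open Counting _≟t_ using () renaming (count to countT; sum-point to sum-pointT; count-filter to count-filterT)

Bounded-++ : ∀ i xs ys → Bounded i xs → Bounded (i + length xs) ys → Bounded i (xs ++ ys)
Bounded-++ i []       ys _ b  = subst (λ j → Bounded j ys) (+-identityʳ i) b
Bounded-++ i (x ∷ xs) ys (h , b) b' =
  h , Bounded-++ (suc i) xs ys b (subst (λ j → Bounded j ys) (+-suc i (length xs)) b')

Bounded-++⁻ˡ : ∀ i xs ys → Bounded i (xs ++ ys) → Bounded i xs
Bounded-++⁻ˡ i []       ys _       = tt
Bounded-++⁻ˡ i (x ∷ xs) ys (h , b) = h , Bounded-++⁻ˡ (suc i) xs ys b

Bounded-weaken : ∀ {i j} w → i ≤ j → Bounded i w → Bounded j w
Bounded-weaken []      _  _                = tt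
Bounded-weaken (x ∷ w) le ((h1 , h2) , b) = (h1 , ≤-trans h2 le) , Bounded-weaken w (s≤s le) b

Bounded-shift : ∀ k i β → Bounded i β → Bounded (k + i) (shift k β)
Bounded-shift k i []       _ = tt
Bounded-shift k i (x ∷ xs) ((h1 , h2) , b) =
  (≤-trans h1 (m≤n+m x k) , +-monoʳ-≤ k h2) ,
  subst (λ j → Bounded j (shift k xs)) (+-suc k i) (Bounded-shift k (suc i) xs b)

Bounded⇒All : ∀ i w → Bounded (suc i) w → All (λ x → 1 ≤ x × x ≤ i + length w) w
Bounded⇒All i []       _ = []
Bounded⇒All i (x ∷ xs) ((h1 , h2) , b) =
  (h1 , ≤-trans h2 (subst (suc i ≤_) (sym (+-suc i (length xs))) (s≤s (m≤m+n i (length xs))))) ∷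
  All.map (λ {z} (p , q) → p , subst (z ≤_) (sym (+-suc i (length xs))) q) (Bounded⇒All (suc i) xs b)

Nondecr : Word → Set
Nondecr = Linked _≤_

Nondecr-++ : ∀ xs y ys → Nondecr xs → All (_≤ y) xs → Nondecr (y ∷ ys) → Nondecr (xs ++ y ∷ ys)
Nondecr-++ []            y ys _        _        l = l
Nondecr-++ (x ∷ [])      y ys _        (h ∷ _)  l = h ∷ l
Nondecr-++ (x ∷ x' ∷ xs) y ys (h ∷ lx) (_ ∷ hs) l = h ∷ Nondecr-++ (x' ∷ xs) y ys lx hs l

Nondecr-++⁻ˡ : ∀ xs ys → Nondecr (xs ++ ys) → Nondecr xs
Nondecr-++⁻ˡ []            ys _       = []
Nondecr-++⁻ˡ (x ∷ [])      ys _       = [-]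
Nondecr-++⁻ˡ (x ∷ x' ∷ xs) ys (h ∷ l) = h ∷ Nondecr-++⁻ˡ (x' ∷ xs) ys l

Nondecr-++⁻ʳ : ∀ xs ys → Nondecr (xs ++ ys) → Nondecr ys
Nondecr-++⁻ʳ []       ys l = l
Nondecr-++⁻ʳ (x ∷ xs) ys l = Nondecr-++⁻ʳ xs ys (Linked.tail l)

Nondecr-shift : ∀ k β → Nondecr β → Nondecr (shift k β)
Nondecr-shift k []           _       = []
Nondecr-shift k (x ∷ [])     _       = [-]
Nondecr-shift k (x ∷ y ∷ xs) (h ∷ l) = +-monoʳ-≤ k h ∷ Nondecr-shift k (y ∷ xs) l

Nondecr-unshift : ∀ k δ → Nondecr δ → Nondecr (map (_∸ k) δ)
Nondecr-unshift k []          _       = []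
Nondecr-unshift k (x ∷ [])    _       = [-]
Nondecr-unshift k (x ∷ y ∷ δ) (h ∷ l) = ∸-monoˡ-≤ k h ∷ Nondecr-unshift k (y ∷ δ) l

Nondecr-head : ∀ y δ → Nondecr (y ∷ δ) → All (y ≤_) δ
Nondecr-head y []      _       = []
Nondecr-head y (z ∷ δ) (h ∷ l) = h ∷ All.map (≤-trans h) (Nondecr-head z δ l)

maxW-++-top : ∀ xs c → All (_≤ c) xs → maxW (xs ++ [ c ]) ≡ c
maxW-++-top []       c _        = ⊔-identityʳ c
maxW-++-top (x ∷ xs) c (h ∷ hs) = trans (cong (x ⊔_) (maxW-++-top xs c hs)) (m≤n⇒m⊔n≡n h)

nodeWord : Word → Word → Word
nodeWord α β = α ++ suc (length α) ∷ shift (length α) β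

-- for bounded α the maximum of α·(|α|+1) is |α|+1, so the ≺ shift is |α|
BW≡nodeWord : ∀ α β → Bounded 1 α → BW α β ≡ nodeWord α β
BW≡nodeWord α β b = begin
  (α ++ [ k + 1 ]) ++ shift (maxW (α ++ [ k + 1 ]) ∸ 1) β
    ≡⟨ cong (λ m → (α ++ [ k + 1 ]) ++ shift (m ∸ 1) β) (maxW-++-top α (k + 1) α≤k+1) ⟩
  (α ++ [ k + 1 ]) ++ shift (k + 1 ∸ 1) β
    ≡⟨ cong (λ m → (α ++ [ k + 1 ]) ++ shift m β) (m+n∸n≡m k 1) ⟩
  (α ++ [ k + 1 ]) ++ shift k β
    ≡⟨ LP.++-assoc α [ k + 1 ] (shift k β) ⟩
  α ++ (k + 1) ∷ shift k β
    ≡⟨ cong (λ m → α ++ m ∷ shift k β) (+-comm k 1) ⟩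
  nodeWord α β ∎
  where
    k = length α
    α≤k+1 : All (_≤ k + 1) α
    α≤k+1 = All.map (λ (_ , q) → ≤-trans q (m≤m+n k 1)) (Bounded⇒All 0 α b)

BW-length : ∀ α β → length (BW α β) ≡ suc (length α + length β)
BW-length α β = begin
  length ((α ++ [ length α + 1 ]) ++ shift _ β)
    ≡⟨ LP.length-++ (α ++ [ length α + 1 ]) ⟩
  length (α ++ [ length α + 1 ]) + length (shift _ β)
    ≡⟨ cong₂ _+_ (LP.length-++ α) (LP.length-map _ β) ⟩
  (length α + 1) + length β
    ≡⟨ +-assoc (length α) 1 (length β) ⟩
  length α + suc (length β)
    ≡⟨ +-suc (length α) (length β) ⟩
  suc (length α + length β) ∎

BW≢[] : ∀ α β → BW α β ≢ []
BW≢[] α β e with trans (sym (BW-length α β)) (cong length e)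
... | ()

nodeWord-NDPF : ∀ α β → IsNDPF α → IsNDPF β → IsNDPF (nodeWord α β)
nodeWord-NDPF α β (lα , bα) (lβ , bβ) =
  Nondecr-++ α (suc k) (shift k β) lα
    (All.map (λ (_ , q) → m≤n⇒m≤1+n q) (Bounded⇒All 0 α bα)) (middle β lβ bβ) ,
  Bounded-++ 1 α (suc k ∷ shift k β) bα ((s≤s z≤n , ≤-refl) ,
    Bounded-weaken (shift k β) (≤-trans (≤-reflexive (+-comm k 1)) (n≤1+n (suc k)))
                   (Bounded-shift k 1 β bβ))
  where
    k = length α
    -- |α|+1 ≤ every letter of β[|α|], since letters of β are ≥ 1
    middle : ∀ β → Nondecr β → Bounded 1 β → Nondecr (suc k ∷ shift k β)
    middle []      _ _               = [-]
    middle (b ∷ β) l ((h1 , _) , _) =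
      subst (_≤ k + b) (+-comm k 1) (+-monoʳ-≤ k h1) ∷ Nondecr-shift k (b ∷ β) l

BW-NDPF : ∀ α β → IsNDPF α → IsNDPF β → IsNDPF (BW α β)
BW-NDPF α β nα nβ = subst IsNDPF (sym (BW≡nodeWord α β (proj₂ nα))) (nodeWord-NDPF α β nα nβ)

-- Injectivity of BW on NDPFs: the middle letter |α|+1 is the last fixed
-- point (letter equal to its position) of nodeWord α β, since every letter
-- of β[|α|] lies strictly below its position.
HasFix : ℕ → Word → Set
HasFix i []       = ⊥
HasFix i (x ∷ xs) = x ≡ i ⊎ HasFix (suc i) xs

shift-noFix : ∀ k i β → Bounded i β → ¬ HasFix (suc (k + i)) (shift k β)
shift-noFix k i []       _ ()
shift-noFix k i (x ∷ xs) ((_ , h2) , b) (inj₁ e) = <-irrefl e (s≤s (+-monoʳ-≤ k h2))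
shift-noFix k i (x ∷ xs) ((_ , h2) , b) (inj₂ f) =
  shift-noFix k (suc i) xs b (subst (λ j → HasFix (suc j) (shift k xs)) (sym (+-suc k i)) f)

fix-at : ∀ i γ x S → x ≡ i + length γ → HasFix i (γ ++ x ∷ S)
fix-at i []      x S e = inj₁ (trans e (+-identityʳ i))
fix-at i (g ∷ γ) x S e = inj₂ (fix-at (suc i) γ x S (trans e (+-suc i (length γ))))

++∷-compare : ∀ (α α' : Word) x x' S S' → α ++ x ∷ S ≡ α' ++ x' ∷ S' →
  (α ≡ α' × S ≡ S') ⊎
  ((Σ Word λ γ → α' ≡ α ++ x ∷ γ × S ≡ γ ++ x' ∷ S') ⊎
   (Σ Word λ γ → α ≡ α' ++ x' ∷ γ × S' ≡ γ ++ x ∷ S))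
++∷-compare []      []        x x' S S' refl = inj₁ (refl , refl)
++∷-compare []      (a' ∷ α') x x' S S' refl = inj₂ (inj₁ (α' , refl , refl))
++∷-compare (a ∷ α) []        x x' S S' refl = inj₂ (inj₂ (α , refl , refl))
++∷-compare (a ∷ α) (a' ∷ α') x x' S S' eq with LP.∷-injective eq
... | refl , eq' with ++∷-compare α α' x x' S S' eq'
...   | inj₁ (refl , e)             = inj₁ (refl , e)
...   | inj₂ (inj₁ (γ , refl , e)) = inj₂ (inj₁ (γ , refl , e))
...   | inj₂ (inj₂ (γ , refl , e)) = inj₂ (inj₂ (γ , refl , e))

middle-in-shift-absurd : ∀ α β γ S → Bounded 1 β →
  shift (length α) β ≡ γ ++ suc (length (α ++ suc (length α) ∷ γ)) ∷ S → ⊥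
middle-in-shift-absurd α β γ S bβ e =
  shift-noFix k 1 β bβ (subst (λ j → HasFix (suc j) (shift k β)) (+-comm 1 k)
    (subst (HasFix (suc (suc k))) (sym e) (fix-at (suc (suc k)) γ _ S len)))
  where
    k = length α
    len : suc (length (α ++ suc k ∷ γ)) ≡ suc (suc k) + length γ
    len = cong suc (trans (LP.length-++ α) (+-suc k (length γ)))

nodeWord-injective : ∀ α β α' β' → Bounded 1 β → Bounded 1 β' →
                     nodeWord α β ≡ nodeWord α' β' → α ≡ α' × β ≡ β'
nodeWord-injective α β α' β' bβ bβ' eq with ++∷-compare α α' _ _ _ _ eq
... | inj₁ (refl , e) = refl , LP.map-injective (λ {a} {b} → +-cancelˡ-≡ (length α) a b) e
... | inj₂ (inj₁ (γ , refl , e)) = ⊥-elim (middle-in-shift-absurd α β γ _ bβ e)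
... | inj₂ (inj₂ (γ , refl , e)) = ⊥-elim (middle-in-shift-absurd α' β' γ _ bβ' e)

BW-injective : ∀ α β α' β' → IsNDPF α → IsNDPF β → IsNDPF α' → IsNDPF β' →
               BW α β ≡ BW α' β' → α ≡ α' × β ≡ β'
BW-injective α β α' β' nα nβ nα' nβ' e =
  nodeWord-injective α β α' β' (proj₂ nβ) (proj₂ nβ')
    (trans (sym (BW≡nodeWord α β (proj₂ nα))) (trans e (BW≡nodeWord α' β' (proj₂ nα'))))

-- Surjectivity: a nonempty NDPF splits at its last fixed point.
-- every letter lies strictly below its position (positions start at i)
BelowPos : ℕ → Word → Set
BelowPos i []       = ⊤
BelowPos i (x ∷ xs) = x < i × BelowPos (suc i) xs

lastFixedPoint : ∀ i w → Bounded i w →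
  BelowPos i w ⊎ (Σ Word λ γ → Σ ℕ λ y → Σ Word λ δ →
                   w ≡ γ ++ y ∷ δ × y ≡ i + length γ × BelowPos (suc y) δ)
lastFixedPoint i []       _ = inj₁ tt
lastFixedPoint i (x ∷ xs) ((h1 , h2) , b) with lastFixedPoint (suc i) xs b
... | inj₂ (γ , y , δ , e , ey , lt) =
  inj₂ (x ∷ γ , y , δ , cong (x ∷_) e , trans ey (sym (+-suc i (length γ))) , lt)
... | inj₁ lt with x ℕ.≟ i
...   | yes refl = inj₂ ([] , x , xs , refl , sym (+-identityʳ x) , lt)
...   | no ne    = inj₁ (≤∧≢⇒< h2 ne , lt)

shift-unshift : ∀ k δ → All (suc k ≤_) δ → δ ≡ shift k (map (_∸ k) δ)
shift-unshift k []      _        = refl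
shift-unshift k (z ∷ δ) (h ∷ hs) =
  cong₂ _∷_ (sym (m+[n∸m]≡n (≤-trans (n≤1+n k) h))) (shift-unshift k δ hs)

Bounded-unshift : ∀ k j δ → BelowPos (suc (k + j)) δ → All (suc k ≤_) δ → Bounded j (map (_∸ k) δ)
Bounded-unshift k j []      _          _        = tt
Bounded-unshift k j (z ∷ δ) (lt , lts) (h ∷ hs) =
  (m<n⇒0<n∸m h , ≤-trans (∸-monoˡ-≤ k (ℕ.s≤s⁻¹ lt)) (≤-reflexive (m+n∸m≡n k j))) ,
  Bounded-unshift k (suc j) δ (subst (λ i → BelowPos (suc i) δ) (sym (+-suc k j)) lts) hs

BW-surjective : ∀ x xs → IsNDPF (x ∷ xs) →
                Σ Word λ α → Σ Word λ β → IsNDPF α × IsNDPF β × BW α β ≡ x ∷ xs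
BW-surjective x xs (l , b) with lastFixedPoint 1 (x ∷ xs) b
... | inj₁ (x<1 , _) = ⊥-elim (<-irrefl refl (≤-trans x<1 (proj₁ (proj₁ b))))
... | inj₂ (γ , y , δ , e , refl , below) = γ , β , (lγ , bγ) , (lβ , bβ) , eqn
  where
    k = length γ
    β = map (_∸ k) δ
    l' : Nondecr (γ ++ suc k ∷ δ)
    l' = subst Nondecr e l
    b' : Bounded 1 (γ ++ suc k ∷ δ)
    b' = subst (Bounded 1) e b
    lγ = Nondecr-++⁻ˡ γ _ l'
    bγ = Bounded-++⁻ˡ 1 γ _ b'
    ly : Nondecr (suc k ∷ δ)
    ly = Nondecr-++⁻ʳ γ _ l'
    δ≥k+1 : All (suc k ≤_) δ
    δ≥k+1 = Nondecr-head (suc k) δ ly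
    lβ = Nondecr-unshift k δ (Linked.tail ly)
    bβ : Bounded 1 β
    bβ = Bounded-unshift k 1 δ (subst (λ i → BelowPos (suc i) δ) (+-comm 1 k) below) δ≥k+1
    eqn : BW γ β ≡ x ∷ xs
    eqn = sym (trans e (trans (cong (λ s → γ ++ suc k ∷ s) (shift-unshift k δ δ≥k+1))
                              (sym (BW≡nodeWord γ β bγ))))

data NDPFView : Word → Set where
  empty : NDPFView []
  split : ∀ α β → IsNDPF α → IsNDPF β → NDPFView (BW α β)

view : ∀ π → IsNDPF π → NDPFView π
view []       _  = empty
view (x ∷ xs) nd with BW-surjective x xs nd
... | α , β , nα , nβ , eq = subst NDPFView eq (split α β nα nβ)

P-self : ∀ w → P w w ≡ 1
P-self w with w ≟w w
... | yes _ = refl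
... | no ne = ⊥-elim (ne refl)

P-BW : ∀ α β α' β' → IsNDPF α → IsNDPF β → IsNDPF α' → IsNDPF β' →
       P α' α * P β' β ≡ P (BW α' β') (BW α β)
P-BW α β α' β' nα nβ nα' nβ' with α ≟w α' | β ≟w β' | BW α β ≟w BW α' β'
... | yes refl | yes refl | yes _ = refl
... | yes refl | yes refl | no ne = ⊥-elim (ne refl)
... | no ne    | _        | yes e = ⊥-elim (ne (proj₁ (BW-injective _ _ _ _ nα nβ nα' nβ' e)))
... | yes _    | no ne    | yes e = ⊥-elim (ne (proj₂ (BW-injective _ _ _ _ nα nβ nα' nβ' e)))
... | no _     | _        | no _  = refl
... | yes _    | no _     | no _  = refl

count-map-suc : ∀ x xs → countℕ (suc x) (map suc xs) ≡ countℕ x xs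
count-map-suc x []       = refl
count-map-suc x (y ∷ xs) with suc y ℕ.≟ suc x | y ℕ.≟ x
... | yes _ | yes _    = cong suc (count-map-suc x xs)
... | yes e | no ne    = ⊥-elim (ne (suc-injective e))
... | no ne | yes refl = ⊥-elim (ne refl)
... | no _  | no _     = count-map-suc x xs

module WordPairs = CountingPairs ℕ._≟_ _≟w_ _≟w_ _∷_ LP.∷-injective

count-words : ∀ n m w → length w ≡ n → All (λ x → 1 ≤ x × x ≤ m) w → countW w (words n m) ≡ 1
count-words zero    m []          _ _ = refl
count-words (suc n) m (suc x ∷ w) e ((_ , h) ∷ hs) = begin
  countW (suc x ∷ w) (WordPairs.pairs (map suc (upTo m)) (words n m))
    ≡⟨ WordPairs.count-pairs (suc x) w (map suc (upTo m)) (words n m) ⟩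
  countℕ (suc x) (map suc (upTo m)) * countW w (words n m)
    ≡⟨ cong₂ _*_ (trans (count-map-suc x (upTo m)) (count-uniqueℕ x (upTo m) (upTo⁺ m) (∈-upTo⁺ h)))
                 (count-words n m w (suc-injective e) hs) ⟩
  1 ∎

words-length : ∀ n m → All (λ w → length w ≡ n) (words n m)
words-length zero    m = refl ∷ []
words-length (suc n) m = AllP.concat⁺ (AllP.map⁺ {xs = map suc (upTo m)}
  (All.tabulate (λ _ → AllP.map⁺ (All.map (cong suc) (words-length n m)))))

∈NDPFs⁻ : ∀ k w → w ∈ NDPFs k → IsNDPF w × length w ≡ k
∈NDPFs⁻ k w m with ∈-filter⁻ isNDPF? {xs = words k k} m
... | m' , nd = nd , All.lookup (words-length k k) m'

-- NDPFs n is words n n filtered by isNDPF?, and an NDPF has letters in [1,n]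
count-NDPFs : ∀ n σ → IsNDPF σ → length σ ≡ n → countW σ (NDPFs n) ≡ 1
count-NDPFs n σ (l , b) refl = trans (count-filterW isNDPF? σ (words n n) (l , b))
  (count-words n n σ refl (Bounded⇒All 0 σ b))

-- the coefficient of P^(BW α₀ β₀) in B(F,H) is F(α₀)·H(β₀): of the triple
-- sum defining B only the term k = |α₀|, α = α₀, β = β₀ survives
module CoefficientOfB (F H : CQ) (α₀ β₀ : Word) (nα₀ : IsNDPF α₀) (nβ₀ : IsNDPF β₀) where
  ρ = BW α₀ β₀
  n = length ρ
  k₀ = length α₀

  term : Word → Word → ℕ
  term α β = if ⌊ BW α β ≟w ρ ⌋ then F α * H β else 0

  inner : ℕ → Word → ℕ
  inner k α = sum (map (term α) (NDPFs (n ∸ 1 ∸ k)))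

  outer : ℕ → ℕ
  outer k = sum (map (inner k) (NDPFs k))

  term-off : ∀ α β → IsNDPF α → IsNDPF β → (α ≢ α₀ ⊎ β ≢ β₀) → term α β ≡ 0
  term-off α β nα nβ d with BW α β ≟w ρ
  ... | no _   = refl
  ... | yes eq with BW-injective α β α₀ β₀ nα nβ nα₀ nβ₀ eq | d
  ...   | eα , _ | inj₁ ne = ⊥-elim (ne eα)
  ...   | _ , eβ | inj₂ ne = ⊥-elim (ne eβ)

  term-on : term α₀ β₀ ≡ F α₀ * H β₀
  term-on with BW α₀ β₀ ≟w ρ
  ... | yes _ = refl
  ... | no ne = ⊥-elim (ne refl)

  k₀<n : k₀ < n
  k₀<n = subst (k₀ <_) (sym (BW-length α₀ β₀)) (s≤s (m≤m+n k₀ (length β₀)))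

  β₀-length : length β₀ ≡ n ∸ 1 ∸ k₀
  β₀-length rewrite BW-length α₀ β₀ = sym (m+n∸m≡n k₀ (length β₀))

  off-k : ∀ k → k ∈ upTo n → k ≢ k₀ → outer k ≡ 0
  off-k k _ ne = sum-zero (inner k) (NDPFs k) λ α mα →
    sum-zero (term α) (NDPFs (n ∸ 1 ∸ k)) λ β mβ →
      term-off α β (proj₁ (∈NDPFs⁻ k α mα)) (proj₁ (∈NDPFs⁻ (n ∸ 1 ∸ k) β mβ))
        (inj₁ (λ eq → ne (trans (sym (proj₂ (∈NDPFs⁻ k α mα))) (cong length eq))))

  off-α : ∀ α → α ∈ NDPFs k₀ → α ≢ α₀ → inner k₀ α ≡ 0
  off-α α mα ne = sum-zero (term α) (NDPFs (n ∸ 1 ∸ k₀)) λ β mβ →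
    term-off α β (proj₁ (∈NDPFs⁻ k₀ α mα)) (proj₁ (∈NDPFs⁻ (n ∸ 1 ∸ k₀) β mβ)) (inj₁ ne)

  off-β : ∀ β → β ∈ NDPFs (n ∸ 1 ∸ k₀) → β ≢ β₀ → term α₀ β ≡ 0
  off-β β mβ ne = term-off α₀ β nα₀ (proj₁ (∈NDPFs⁻ (n ∸ 1 ∸ k₀) β mβ)) (inj₂ ne)

  coefficient : B F H ρ ≡ F α₀ * H β₀
  coefficient = begin
    sum (map outer (upTo n))
      ≡⟨ Counting.sum-point ℕ._≟_ outer k₀ (upTo n)
           (count-uniqueℕ k₀ (upTo n) (upTo⁺ n) (∈-upTo⁺ k₀<n)) off-k ⟩
    outer k₀
      ≡⟨ sum-pointW (inner k₀) α₀ (NDPFs k₀) (count-NDPFs k₀ α₀ nα₀ refl) off-α ⟩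
    inner k₀ α₀
      ≡⟨ sum-pointW (term α₀) β₀ (NDPFs (n ∸ 1 ∸ k₀)) (count-NDPFs _ β₀ nβ₀ β₀-length) off-β ⟩
    term α₀ β₀
      ≡⟨ term-on ⟩
    F α₀ * H β₀ ∎

B-at-BW : ∀ F H α β → IsNDPF α → IsNDPF β → B F H (BW α β) ≡ F α * H β
B-at-BW F H α β nα nβ = CoefficientOfB.coefficient F H α β nα nβ

sort-unique : ∀ a π → Nondecr π → a ↭ π → a ↑ ≡ π
sort-unique a π lπ p = Pointwise-≡⇒≡ (Sorted.↗↭↗⇒≋ (DecTotalOrder.totalOrder ≤-decTotalOrder)
  (sort-↗ a) lπ (↭⇒↭ₛ (↭-trans (sort-↭ a) p)))

G-in-PQSym : ∀ a → IsPF a → sumAllP-PQ a ≡ 1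
G-in-PQSym a (π₀ , (lπ₀ , bπ₀) , p) = begin
  sum (map (λ π → P-PQ π a) (NDPFs (length a)))
    ≡⟨ sum-pointW _ π₀ _ (count-NDPFs (length a) π₀ (lπ₀ , bπ₀) (sym (↭-length p))) off-π₀ ⟩
  P-PQ π₀ a
    ≡⟨ cong (λ w → indicator (w ≟w π₀)) a↑≡π₀ ⟩
  P π₀ π₀
    ≡⟨ P-self π₀ ⟩
  1 ∎
  where
    a↑≡π₀ : a ↑ ≡ π₀
    a↑≡π₀ = sort-unique a π₀ lπ₀ p
    off-π₀ : ∀ π → π ∈ NDPFs (length a) → π ≢ π₀ → P-PQ π a ≡ 0
    off-π₀ π _ ne with (a ↑) ≟w π
    ... | yes e = ⊥-elim (ne (trans (sym e) a↑≡π₀))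
    ... | no _  = refl

G-fixed-point : sumAllP ≈ (𝟙 ⊕ B sumAllP sumAllP)
G-fixed-point π nd with view π nd
... | empty            = refl
... | split α β nα nβ = sym (cong₂ _+_ (𝟙-at-BW α β) (B-at-BW sumAllP sumAllP α β nα nβ))
  where
    𝟙-at-BW : ∀ α β → 𝟙 (BW α β) ≡ 0
    𝟙-at-BW α β with BW α β ≟w []
    ... | yes e = ⊥-elim (BW≢[] α β e)
    ... | no _  = refl

π : Tree → Word
π leaf       = []
π (node l r) = BW (π l) (π r)

π-NDPF : ∀ T → IsNDPF (π T)
π-NDPF leaf       = [] , tt
π-NDPF (node l r) = BW-NDPF (π l) (π r) (π-NDPF l) (π-NDPF r)

π-length : ∀ T → length (π T) ≡ size T
π-length leaf       = refl
π-length (node l r) = trans (BW-length (π l) (π r)) (cong suc (cong₂ _+_ (π-length l) (π-length r)))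

-- π is injective, since BW is injective on NDPFs and never empty
π-injective : ∀ T T′ → π T ≡ π T′ → T ≡ T′
π-injective leaf       leaf         _ = refl
π-injective leaf       (node l r)   e = ⊥-elim (BW≢[] (π l) (π r) (sym e))
π-injective (node l r) leaf         e = ⊥-elim (BW≢[] (π l) (π r) e)
π-injective (node l r) (node l′ r′) e
  with BW-injective _ _ _ _ (π-NDPF l) (π-NDPF r) (π-NDPF l′) (π-NDPF r′) e
... | el , er = cong₂ node (π-injective l l′ el) (π-injective r r′ er)

-- recursion on a length bound f, since the pieces of BW α β are shorter
π-surjective-bounded : ∀ f σ → length σ ≤ f → IsNDPF σ → Σ Tree λ T → π T ≡ σ
π-surjective-bounded f       []       _  _  = leaf , refl
π-surjective-bounded zero    (x ∷ xs) () _
π-surjective-bounded (suc f) (x ∷ xs) le nd with BW-surjective x xs nd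
... | α , β , nα , nβ , eq =
  node (proj₁ left) (proj₁ right) , trans (cong₂ BW (proj₂ left) (proj₂ right)) eq
  where
    pieces≤f : length α + length β ≤ f
    pieces≤f = ℕ.s≤s⁻¹ (subst (_≤ suc f) (trans (cong length (sym eq)) (BW-length α β)) le)
    left  = π-surjective-bounded f α (≤-trans (m≤m+n _ _) pieces≤f) nα
    right = π-surjective-bounded f β (≤-trans (m≤n+m _ _) pieces≤f) nβ

π-surjective : ∀ σ → IsNDPF σ → Σ Tree λ T → π T ≡ σ
π-surjective σ = π-surjective-bounded (length σ) σ ≤-refl

BT≈P : ∀ T → BT T ≈ P (π T)
BT≈P leaf       ρ _ = refl
BT≈P (node l r) ρ nd with view ρ nd
... | empty with [] ≟w BW (π l) (π r)
...   | yes e = ⊥-elim (BW≢[] (π l) (π r) (sym e))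
...   | no _  = refl
BT≈P (node l r) ρ nd | split α β nα nβ = begin
  B (BT l) (BT r) (BW α β)        ≡⟨ B-at-BW (BT l) (BT r) α β nα nβ ⟩
  BT l α * BT r β                 ≡⟨ cong₂ _*_ (BT≈P l α nα) (BT≈P r β nβ) ⟩
  P (π l) α * P (π r) β           ≡⟨ P-BW α β (π l) (π r) nα nβ (π-NDPF l) (π-NDPF r) ⟩
  P (π (node l r)) (BW α β)       ∎

depth : Tree → ℕ
depth leaf       = 0
depth (node l r) = suc (depth l ⊔ depth r)

depth≤size : ∀ T → depth T ≤ size T
depth≤size leaf       = z≤n
depth≤size (node l r) =
  s≤s (⊔-lub (≤-trans (depth≤size l) (m≤m+n _ _)) (≤-trans (depth≤size r) (m≤n+m _ _)))

-- the enumeration of trees of bounded depth is a product table over node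
node-injective : ∀ {a b a' b'} → node a b ≡ node a' b' → a ≡ a' × b ≡ b'
node-injective refl = refl , refl

module TreePairs = CountingPairs _≟t_ _≟t_ _≟t_ node node-injective

count-treesDepth : ∀ d T → depth T ≤ d → countT T (treesDepth d) ≡ 1
count-treesDepth zero    leaf       _ = refl
count-treesDepth (suc d) leaf       _ =
  cong suc (TreePairs.count-pairs-absent leaf (treesDepth d) (treesDepth d) (λ _ _ ()))
count-treesDepth (suc d) (node l r) (s≤s le) =
  trans (TreePairs.count-pairs l r (treesDepth d) (treesDepth d))
        (cong₂ _*_ (count-treesDepth d l (≤-trans (m≤m⊔n _ _) le))
                   (count-treesDepth d r (≤-trans (m≤n⊔m _ _) le)))

-- treesOfSize n is treesDepth n filtered by size, and depth ≤ size
count-treesOfSize : ∀ n T → size T ≡ n → countT T (treesOfSize n) ≡ 1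
count-treesOfSize n T e = trans (count-filterT (λ t → size t ℕ.≟ n) T (treesDepth n) e)
  (count-treesDepth n T (subst (depth T ≤_) e (depth≤size T)))

-- Σ_T B_T(1) = G: at an NDPF ρ only the tree T₀ with π T₀ = ρ contributes
G≈sumTrees : sumAllP ≈ sumTrees
G≈sumTrees ρ nd = sym (begin
  sum (map (λ t → BT t ρ) (treesOfSize (length ρ)))
    ≡⟨ sum-pointT (λ t → BT t ρ) T₀ (treesOfSize (length ρ))
         (count-treesOfSize (length ρ) T₀ (trans (sym (π-length T₀)) (cong length πT₀≡ρ))) off-T₀ ⟩
  BT T₀ ρ      ≡⟨ BT≈P T₀ ρ nd ⟩
  P (π T₀) ρ   ≡⟨ cong (λ w → P w ρ) πT₀≡ρ ⟩
  P ρ ρ        ≡⟨ P-self ρ ⟩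
  1 ∎)
  where
    T₀ = proj₁ (π-surjective ρ nd)
    πT₀≡ρ = proj₂ (π-surjective ρ nd)
    off-T₀ : ∀ t → t ∈ treesOfSize (length ρ) → t ≢ T₀ → BT t ρ ≡ 0
    off-T₀ t _ ne with ρ ≟w π t | BT≈P t ρ nd
    ... | yes e | _ = ⊥-elim (ne (π-injective t T₀ (trans (sym e) (sym πT₀≡ρ))))
    ... | no _  | q = q

mainTheorem4 :
    (∀ a → IsPF a → sumAllP-PQ a ≡ 1)
    × (sumAllP ≈ (𝟙 ⊕ B sumAllP sumAllP))
    × Σ (Tree → Word) (λ π →
        (∀ T → IsNDPF (π T) × (BT T ≈ P (π T)))
        × (sumAllP ≈ sumTrees)
        × (∀ T → length (π T) ≡ size T)
        × (∀ (n : ℕ) (T T′ : Tree) → size T ≡ n → size T′ ≡ n → π T ≡ π T′ → T ≡ T′)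
        × (∀ (n : ℕ) (σ : Word) → IsNDPF σ → length σ ≡ n →
             Σ Tree (λ T → size T ≡ n × π T ≡ σ)))
mainTheorem4 =
  G-in-PQSym ,
  G-fixed-point ,
  π ,
  (λ T → π-NDPF T , BT≈P T) ,
  G≈sumTrees ,
  π-length ,
  (λ n T T′ _ _ → π-injective T T′) ,
  preimage
  where
    preimage : ∀ n σ → IsNDPF σ → length σ ≡ n → Σ Tree (λ T → size T ≡ n × π T ≡ σ)
    preimage n σ nd len with π-surjective σ nd
    ... | T , πT≡σ = T , trans (sym (π-length T)) (trans (cong length πT≡σ) len) , πT≡σ
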